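{- The set $\mathcal{B}$ of all blocking games is outcome-stable: for all strictly $\mathscr{P}$-free $G,H\in\mathcal{B}$, (1) if $o(G)=o(H)=\mathscr{L}$ then $o(G+H)=\mathscr{L}$; (2) if $o(G)=o(H)=\mathscr{R}$ then $o(G+H)=\mathscr{R}$; (3) if $o(G)=\mathscr{L}$ and $o(H)=\mathscr{N}$ then $o_L(G+H)=\mathscr{L}$; (4) if $o(G)=\mathscr{R}$ and $o(H)=\mathscr{N}$ then $o_R(G+H)=\mathscr{R}$.
   Context: Games are short misère-play game forms (no tombstones); outcomes $o(G)\in\{\mathscr{L},\mathscr{N},\mathscr{P},\mathscr{R}\}$, and $o_L(G)$, $o_R(G)$ denote the winner when Left, resp. Right, moves first. $+$ is disjunctive sum. A subposition of $G$ is any game reachable by a possibly empty, not necessarily alternating, sequence of moves; $G$ is strictly $\mathscr{P}$-free if no subposition has outcome $\mathscr{P}$. A Left end is a game with no Left options. A Left end $X$ is blocked if for every Right option $X^R$, either $X^R$ is a blocked Left end or some Left option $X^{RL}$ of $X^R$ is a blocked Left end; blocked Right ends symmetrically. A game is blocking if every subposition that is a Left (resp. Right) end is a blocked Left (resp. Right) end. -}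

module Defs where

open import Data.Bool using (Bool; true; false; not; _∧_; _∨_)
open import Data.List using (List; []; _∷_; _++_)
open import Data.List.Membership.Propositional using (_∈_)
open import Data.Product using (Σ; _×_)
open import Data.Sum using (_⊎_)
open import Relation.Binary.PropositionalEquality using (_≡_; _≢_)

data Game : Set where
  mk : List Game → List Game → Game

leftOpts : Game → List Game
leftOpts (mk l _) = l

rightOpts : Game → List Game
rightOpts (mk _ r) = r

-- Misère play: a player with no move available wins.
-- leftFirst G  = true iff Left wins G moving first.
-- rightFirst G = true iff Right wins G moving first.
mutual
  leftFirst : Game → Bool
  leftFirst (mk [] _) = true
  leftFirst (mk (x ∷ xs) _) = anyLeft (x ∷ xs)

  rightFirst : Game → Bool
  rightFirst (mk _ []) = true
  rightFirst (mk _ (x ∷ xs)) = anyRight (x ∷ xs)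

  anyLeft : List Game → Bool
  anyLeft [] = false
  anyLeft (x ∷ xs) = not (rightFirst x) ∨ anyLeft xs

  anyRight : List Game → Bool
  anyRight [] = false
  anyRight (x ∷ xs) = not (leftFirst x) ∨ anyRight xs

data Player : Set where
  Left Right : Player

oL : Game → Player
oL G with leftFirst G
... | true = Left
... | false = Right

oR : Game → Player
oR G with rightFirst G
... | true = Right
... | false = Left

data Outcome : Set where
  𝓛 𝓝 𝓟 𝓡 : Outcome

outcome : Game → Outcome
outcome G with oL G | oR G
... | Left  | Left  = 𝓛
... | Left  | Right = 𝓝
... | Right | Left  = 𝓟
... | Right | Right = 𝓡

mutual
  _+_ : Game → Game → Game
  G@(mk gl gr) + H@(mk hl hr) =
    mk (sumL gl H ++ sumR G hl) (sumL gr H ++ sumR G hr)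

  sumL : List Game → Game → List Game
  sumL [] H = []
  sumL (x ∷ xs) H = (x + H) ∷ sumL xs H

  sumR : Game → List Game → List Game
  sumR G [] = []
  sumR G (y ∷ ys) = (G + y) ∷ sumR G ys

data Subpos : Game → Game → Set where
  here  : ∀ {G} → Subpos G G
  viaL  : ∀ {H G X} → X ∈ leftOpts G → Subpos H X → Subpos H G
  viaR  : ∀ {H G X} → X ∈ rightOpts G → Subpos H X → Subpos H G

StrictlyPFree : Game → Set
StrictlyPFree G = ∀ H → Subpos H G → outcome H ≢ 𝓟

data BlockedLeftEnd : Game → Set where
  blockedL : ∀ {xr} →
    (∀ Y → Y ∈ xr →
       BlockedLeftEnd Y ⊎ Σ Game (λ Z → Z ∈ leftOpts Y × BlockedLeftEnd Z)) →
    BlockedLeftEnd (mk [] xr)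

data BlockedRightEnd : Game → Set where
  blockedR : ∀ {xl} →
    (∀ Y → Y ∈ xl →
       BlockedRightEnd Y ⊎ Σ Game (λ Z → Z ∈ rightOpts Y × BlockedRightEnd Z)) →
    BlockedRightEnd (mk xl [])

Blocking : Game → Set
Blocking G = ∀ H → Subpos H G →
  (leftOpts H ≡ [] → BlockedLeftEnd H) × (rightOpts H ≡ [] → BlockedRightEnd H)

{-# OPTIONS --safe #-}
module Submission where

-- Write G ∈ 𝓛 when Left wins G whoever moves first.  For G, H ∈ 𝓛, Left moving first in G + H
-- plays a winning move of G; since G is strictly P-free that move lands in 𝓛, and induction
-- applies.  If G has no Left move it is a blocked Left end, and adding a blocked Left end X to a
-- P-free G ∈ 𝓛 keeps it in 𝓛: each Right move inside X reaches a blocked Left end, at once or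
-- after one Left reply.  Right moving first reaches G^R + H or G + H^R with G^R, H^R ∈ 𝓛 ∪ 𝓝,
-- so the induction is run for the stronger claim that Left wins G + H moving first whenever
-- Left wins G moving first and H ∈ 𝓛; as + commutes up to outcome, this also gives (3).
-- Conjugation exchanges the players and distributes over +, which gives (2) and (4).

open import Defs
open import Data.Bool using (true; false; not; _∨_)
open import Data.Bool.Properties using (∨-zeroʳ; ∨-conicalˡ; ∨-conicalʳ; not-injective; ¬-not)
open import Data.List using (List; []; _∷_; _++_)
open import Data.List.Membership.Propositional using (_∈_)
open import Data.List.Membership.Propositional.Properties using (∈-++⁺ˡ; ∈-++⁺ʳ; ∈-++⁻)
open import Data.List.Relation.Unary.Any using (here; there)
open import Data.Product using (_×_; ∃-syntax; _,_; proj₁; proj₂)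
open import Data.Sum using (_⊎_; inj₁; inj₂)
open import Function using (_∘_)
open import Induction.WellFounded using (Acc; acc; WellFounded)
open import Relation.Binary.PropositionalEquality
  using (_≡_; _≢_; refl; sym; trans; cong; cong₂; subst; module ≡-Reasoning)

anyLeft-true : ∀ {X xs} → X ∈ xs → rightFirst X ≡ false → anyLeft xs ≡ true
anyLeft-true (here refl) r rewrite r = refl
anyLeft-true {xs = x ∷ _} (there X∈xs) r rewrite anyLeft-true X∈xs r =
  ∨-zeroʳ (not (rightFirst x))

anyLeft-true⁻ : ∀ xs → anyLeft xs ≡ true → ∃[ X ] X ∈ xs × rightFirst X ≡ false
anyLeft-true⁻ (x ∷ xs) l with rightFirst x in r
... | false = x , here refl , r
... | true  with anyLeft-true⁻ xs l
...   | X , X∈xs , r′ = X , there X∈xs , r′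

anyRight-false : ∀ {xs} → (∀ {X} → X ∈ xs → leftFirst X ≡ true) → anyRight xs ≡ false
anyRight-false {[]}    _ = refl
anyRight-false {_ ∷ _} l rewrite l (here refl) = anyRight-false (l ∘ there)

anyRight-false⁻ : ∀ {X xs} → anyRight xs ≡ false → X ∈ xs → leftFirst X ≡ true
anyRight-false⁻ {xs = x ∷ xs} r (here refl) =
  not-injective (∨-conicalˡ (not (leftFirst x)) (anyRight xs) r)
anyRight-false⁻ {xs = x ∷ xs} r (there X∈xs) =
  anyRight-false⁻ (∨-conicalʳ (not (leftFirst x)) (anyRight xs) r) X∈xs

leftFirst-end : ∀ G → leftOpts G ≡ [] → leftFirst G ≡ true
leftFirst-end (mk [] _) _ = refl

leftFirst-move : ∀ G {X} → X ∈ leftOpts G → rightFirst X ≡ false → leftFirst G ≡ true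
leftFirst-move (mk (_ ∷ _) _) = anyLeft-true

leftFirst-true⁻ : ∀ G → leftFirst G ≡ true →
  leftOpts G ≡ [] ⊎ ∃[ X ] X ∈ leftOpts G × rightFirst X ≡ false
leftFirst-true⁻ (mk []       _) _ = inj₁ refl
leftFirst-true⁻ (mk (x ∷ xs) _) l = inj₂ (anyLeft-true⁻ (x ∷ xs) l)

rightFirst-false : ∀ G {X} → X ∈ rightOpts G →
  (∀ {Y} → Y ∈ rightOpts G → leftFirst Y ≡ true) → rightFirst G ≡ false
rightFirst-false (mk _ (_ ∷ _)) _ = anyRight-false

rightFirst-false⇒option : ∀ G → rightFirst G ≡ false → ∃[ X ] X ∈ rightOpts G
rightFirst-false⇒option (mk _ [])      ()
rightFirst-false⇒option (mk _ (x ∷ _)) _ = x , here refl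

rightFirst-false⁻ : ∀ G → rightFirst G ≡ false → ∀ {X} → X ∈ rightOpts G → leftFirst X ≡ true
rightFirst-false⁻ (mk _ (_ ∷ _)) r = anyRight-false⁻ r

∈-sumL : ∀ {X xs H} → X ∈ xs → X + H ∈ sumL xs H
∈-sumL (here refl)  = here refl
∈-sumL (there X∈xs) = there (∈-sumL X∈xs)

∈-sumR : ∀ {Y ys G} → Y ∈ ys → G + Y ∈ sumR G ys
∈-sumR (here refl)  = here refl
∈-sumR (there Y∈ys) = there (∈-sumR Y∈ys)

∈-sumL⁻ : ∀ {Z} xs H → Z ∈ sumL xs H → ∃[ X ] X ∈ xs × Z ≡ X + H
∈-sumL⁻ (x ∷ _)  _ (here refl) = x , here refl , refl
∈-sumL⁻ (_ ∷ xs) H (there Z∈)  with ∈-sumL⁻ xs H Z∈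
... | X , X∈xs , refl = X , there X∈xs , refl

∈-sumR⁻ : ∀ {Z} G ys → Z ∈ sumR G ys → ∃[ Y ] Y ∈ ys × Z ≡ G + Y
∈-sumR⁻ _ (y ∷ _)  (here refl) = y , here refl , refl
∈-sumR⁻ G (_ ∷ ys) (there Z∈)  with ∈-sumR⁻ G ys Z∈
... | Y , Y∈ys , refl = Y , there Y∈ys , refl

∈-leftOpts-+ˡ : ∀ G H {X} → X ∈ leftOpts G → X + H ∈ leftOpts (G + H)
∈-leftOpts-+ˡ (mk _ _) (mk _ _) = ∈-++⁺ˡ ∘ ∈-sumL

∈-leftOpts-+ʳ : ∀ G H {Y} → Y ∈ leftOpts H → G + Y ∈ leftOpts (G + H)
∈-leftOpts-+ʳ (mk gl _) (mk _ _) = ∈-++⁺ʳ (sumL gl _) ∘ ∈-sumR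

∈-rightOpts-+ˡ : ∀ G H {X} → X ∈ rightOpts G → X + H ∈ rightOpts (G + H)
∈-rightOpts-+ˡ (mk _ _) (mk _ _) = ∈-++⁺ˡ ∘ ∈-sumL

∈-rightOpts-+ʳ : ∀ G H {Y} → Y ∈ rightOpts H → G + Y ∈ rightOpts (G + H)
∈-rightOpts-+ʳ (mk _ gr) (mk _ _) = ∈-++⁺ʳ (sumL gr _) ∘ ∈-sumR

leftOpts-+⁻ : ∀ G H {Z} → Z ∈ leftOpts (G + H) →
  (∃[ X ] X ∈ leftOpts G × Z ≡ X + H) ⊎ (∃[ Y ] Y ∈ leftOpts H × Z ≡ G + Y)
leftOpts-+⁻ G@(mk gl _) H@(mk hl _) Z∈ with ∈-++⁻ (sumL gl H) Z∈
... | inj₁ Z∈ˡ = inj₁ (∈-sumL⁻ gl H Z∈ˡ)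
... | inj₂ Z∈ʳ = inj₂ (∈-sumR⁻ G hl Z∈ʳ)

rightOpts-+⁻ : ∀ G H {Z} → Z ∈ rightOpts (G + H) →
  (∃[ X ] X ∈ rightOpts G × Z ≡ X + H) ⊎ (∃[ Y ] Y ∈ rightOpts H × Z ≡ G + Y)
rightOpts-+⁻ G@(mk _ gr) H@(mk _ hr) Z∈ with ∈-++⁻ (sumL gr H) Z∈
... | inj₁ Z∈ˡ = inj₁ (∈-sumL⁻ gr H Z∈ˡ)
... | inj₂ Z∈ʳ = inj₂ (∈-sumR⁻ G hr Z∈ʳ)

leftOpts-+-[] : ∀ G H → leftOpts G ≡ [] → leftOpts H ≡ [] → leftOpts (G + H) ≡ []
leftOpts-+-[] (mk [] _) (mk [] _) _ _ = refl

leftOpts-+-comm-[] : ∀ G H → leftOpts (G + H) ≡ [] → leftOpts (H + G) ≡ []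
leftOpts-+-comm-[] (mk []      _) (mk []      _) _ = refl
leftOpts-+-comm-[] (mk (_ ∷ _) _) (mk _       _) ()
leftOpts-+-comm-[] (mk []      _) (mk (_ ∷ _) _) ()

_⊏_ : Game → Game → Set
X ⊏ G = X ∈ leftOpts G ⊎ X ∈ rightOpts G

mutual
  ⊏-wellFounded : WellFounded _⊏_
  ⊏-wellFounded (mk l r) = acc λ where
    (inj₁ X∈l) → ∈⇒Acc l X∈l
    (inj₂ X∈r) → ∈⇒Acc r X∈r

  ∈⇒Acc : ∀ xs {X} → X ∈ xs → Acc _⊏_ X
  ∈⇒Acc (x ∷ _)  (here refl)  = ⊏-wellFounded x
  ∈⇒Acc (_ ∷ xs) (there X∈xs) = ∈⇒Acc xs X∈xs

Subpos-⊏ : ∀ {K X G} → X ⊏ G → Subpos K X → Subpos K G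
Subpos-⊏ (inj₁ X∈) = viaL X∈
Subpos-⊏ (inj₂ X∈) = viaR X∈

Hereditarily : (Game → Set) → Game → Set
Hereditarily P G = ∀ K → Subpos K G → P K

Hereditarily-⊏ : ∀ {P X G} → X ⊏ G → Hereditarily P G → Hereditarily P X
Hereditarily-⊏ X⊏G h K = h K ∘ Subpos-⊏ X⊏G

Hereditarily-map : ∀ {P Q G} → (∀ {K} → P K → Q K) → Hereditarily P G → Hereditarily Q G
Hereditarily-map f h K = f ∘ h K

-- Commutativity of +

mutual
  leftFirst-+-comm : ∀ {G H} → Acc _⊏_ G → Acc _⊏_ H →
    leftFirst (G + H) ≡ true → leftFirst (H + G) ≡ true
  leftFirst-+-comm {G} {H} aG@(acc rsG) aH@(acc rsH) l with leftFirst-true⁻ (G + H) l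
  ... | inj₁ noMove = leftFirst-end (H + G) (leftOpts-+-comm-[] G H noMove)
  ... | inj₂ (_ , Z∈ , rZ) with leftOpts-+⁻ G H Z∈
  ...   | inj₁ (X , X∈ , refl) = leftFirst-move (H + G) (∈-leftOpts-+ʳ H G X∈)
                                   (rightFirst-+-comm (rsG (inj₁ X∈)) aH rZ)
  ...   | inj₂ (Y , Y∈ , refl) = leftFirst-move (H + G) (∈-leftOpts-+ˡ H G Y∈)
                                   (rightFirst-+-comm aG (rsH (inj₁ Y∈)) rZ)

  rightFirst-+-comm : ∀ {G H} → Acc _⊏_ G → Acc _⊏_ H →
    rightFirst (G + H) ≡ false → rightFirst (H + G) ≡ false
  rightFirst-+-comm {G} {H} aG@(acc rsG) aH@(acc rsH) r =
    rightFirst-false (H + G) (proj₂ (swapped (proj₂ (rightFirst-false⇒option (G + H) r))))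
      rightMove
    where
    swapped : ∀ {Z} → Z ∈ rightOpts (G + H) → ∃[ Z′ ] Z′ ∈ rightOpts (H + G)
    swapped Z∈ with rightOpts-+⁻ G H Z∈
    ... | inj₁ (_ , X∈ , _) = _ , ∈-rightOpts-+ʳ H G X∈
    ... | inj₂ (_ , Y∈ , _) = _ , ∈-rightOpts-+ˡ H G Y∈

    rightMove : ∀ {Z} → Z ∈ rightOpts (H + G) → leftFirst Z ≡ true
    rightMove Z∈ with rightOpts-+⁻ H G Z∈
    ... | inj₁ (Y , Y∈ , refl) = leftFirst-+-comm aG (rsH (inj₂ Y∈))
                                   (rightFirst-false⁻ (G + H) r (∈-rightOpts-+ʳ G H Y∈))
    ... | inj₂ (X , X∈ , refl) = leftFirst-+-comm (rsG (inj₂ X∈)) aH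
                                   (rightFirst-false⁻ (G + H) r (∈-rightOpts-+ˡ G H X∈))

-- Adding a blocked Left end to an 𝓛-position

Is𝓛 : Game → Set
Is𝓛 G = leftFirst G ≡ true × rightFirst G ≡ false

outcome≡𝓟 : ∀ G → leftFirst G ≡ false → rightFirst G ≡ false → outcome G ≡ 𝓟
outcome≡𝓟 _ l r rewrite l | r = refl

rightFirst-false⇒𝓛 : ∀ G → outcome G ≢ 𝓟 → rightFirst G ≡ false → Is𝓛 G
rightFirst-false⇒𝓛 G not𝓟 r = ¬-not (λ l → not𝓟 (outcome≡𝓟 G l r)) , r

NearBlockedLeftEnd : Game → Set
NearBlockedLeftEnd Y = BlockedLeftEnd Y ⊎ ∃[ V ] V ∈ leftOpts Y × BlockedLeftEnd V

mutual
  Is𝓛-+-blocked : ∀ {G X} → Acc _⊏_ G → Acc _⊏_ X → StrictlyPFree G → BlockedLeftEnd X →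
    Is𝓛 G → Is𝓛 (G + X)
  Is𝓛-+-blocked {G} {X} aG@(acc rsG) aX@(acc rsX) pG bX@(blockedL blocked) 𝓛G@(lG , rG) =
    leftFirst-+-blocked aG aX pG bX lG ,
    rightFirst-false (G + X) (∈-rightOpts-+ˡ G X (proj₂ (rightFirst-false⇒option G rG)))
      rightMove
    where
    rightMove : ∀ {Z} → Z ∈ rightOpts (G + X) → leftFirst Z ≡ true
    rightMove Z∈ with rightOpts-+⁻ G X Z∈
    ... | inj₁ (Y , Y∈ , refl) = leftFirst-+-blocked (rsG (inj₂ Y∈)) aX
                                   (Hereditarily-⊏ (inj₂ Y∈) pG) bX (rightFirst-false⁻ G rG Y∈)
    ... | inj₂ (Y , Y∈ , refl) = leftFirst-+-nearBlocked aG (rsX (inj₂ Y∈)) pG 𝓛G (blocked Y Y∈)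

  leftFirst-+-nearBlocked : ∀ {G Y} → Acc _⊏_ G → Acc _⊏_ Y → StrictlyPFree G → Is𝓛 G →
    NearBlockedLeftEnd Y → leftFirst (G + Y) ≡ true
  leftFirst-+-nearBlocked aG aY pG 𝓛G (inj₁ bY) = proj₁ (Is𝓛-+-blocked aG aY pG bY 𝓛G)
  leftFirst-+-nearBlocked {G} {Y} aG (acc rsY) pG 𝓛G (inj₂ (V , V∈ , bV)) =
    leftFirst-move (G + Y) (∈-leftOpts-+ʳ G Y V∈)
      (proj₂ (Is𝓛-+-blocked aG (rsY (inj₁ V∈)) pG bV 𝓛G))

  leftFirst-+-blocked : ∀ {G X} → Acc _⊏_ G → Acc _⊏_ X → StrictlyPFree G → BlockedLeftEnd X →
    leftFirst G ≡ true → leftFirst (G + X) ≡ true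
  leftFirst-+-blocked {G} {X} (acc rsG) aX pG bX@(blockedL _) lG with leftFirst-true⁻ G lG
  ... | inj₁ noMove        = leftFirst-end (G + X) (leftOpts-+-[] G X noMove refl)
  ... | inj₂ (Y , Y∈ , rY) =
        leftFirst-move (G + X) (∈-leftOpts-+ˡ G X Y∈)
          (proj₂ (Is𝓛-+-blocked (rsG (inj₁ Y∈)) aX pY bX (rightFirst-false⇒𝓛 Y (pY Y here) rY)))
    where
    pY : StrictlyPFree Y
    pY = Hereditarily-⊏ (inj₁ Y∈) pG

-- Sums of 𝓛-positions

-- What Left's argument needs of each subposition.
record Admissible (K : Game) : Set where
  field
    not𝓟            : outcome K ≢ 𝓟
    leftEnd-blocked : leftOpts K ≡ [] → BlockedLeftEnd K

mutual
  Is𝓛-+ : ∀ {G H} → Acc _⊏_ G → Acc _⊏_ H →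
    Hereditarily Admissible G → Hereditarily Admissible H → Is𝓛 G → Is𝓛 H → Is𝓛 (G + H)
  Is𝓛-+ {G} {H} aG@(acc rsG) aH@(acc rsH) hG hH 𝓛G@(lG , rG) 𝓛H@(_ , rH) =
    leftFirst-+ˡ aG aH hG hH lG 𝓛H ,
    rightFirst-false (G + H) (∈-rightOpts-+ˡ G H (proj₂ (rightFirst-false⇒option G rG)))
      rightMove
    where
    rightMove : ∀ {Z} → Z ∈ rightOpts (G + H) → leftFirst Z ≡ true
    rightMove Z∈ with rightOpts-+⁻ G H Z∈
    ... | inj₁ (X , X∈ , refl) = leftFirst-+ˡ (rsG (inj₂ X∈)) aH (Hereditarily-⊏ (inj₂ X∈) hG) hH
                                   (rightFirst-false⁻ G rG X∈) 𝓛H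
    ... | inj₂ (Y , Y∈ , refl) = leftFirst-+ʳ aG (rsH (inj₂ Y∈)) hG (Hereditarily-⊏ (inj₂ Y∈) hH)
                                   𝓛G (rightFirst-false⁻ H rH Y∈)

  leftFirst-+ˡ : ∀ {G H} → Acc _⊏_ G → Acc _⊏_ H →
    Hereditarily Admissible G → Hereditarily Admissible H →
    leftFirst G ≡ true → Is𝓛 H → leftFirst (G + H) ≡ true
  leftFirst-+ˡ {G} {H} (acc rsG) aH hG hH lG 𝓛H with leftFirst-true⁻ G lG
  ... | inj₁ noMove =
        leftFirst-+-comm aH (acc rsG)
          (proj₁ (Is𝓛-+-blocked aH (acc rsG) (Hereditarily-map Admissible.not𝓟 hH)
                   (Admissible.leftEnd-blocked (hG G here) noMove) 𝓛H))
  ... | inj₂ (X , X∈ , rX) =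
        leftFirst-move (G + H) (∈-leftOpts-+ˡ G H X∈)
          (proj₂ (Is𝓛-+ (rsG (inj₁ X∈)) aH hX hH
                   (rightFirst-false⇒𝓛 X (Admissible.not𝓟 (hX X here)) rX) 𝓛H))
    where
    hX : Hereditarily Admissible X
    hX = Hereditarily-⊏ (inj₁ X∈) hG

  -- Terminates despite swapping the summands: every cycle through this call also shrinks one
  -- of the two accessibility arguments.
  leftFirst-+ʳ : ∀ {G H} → Acc _⊏_ G → Acc _⊏_ H →
    Hereditarily Admissible G → Hereditarily Admissible H →
    Is𝓛 G → leftFirst H ≡ true → leftFirst (G + H) ≡ true
  leftFirst-+ʳ aG aH hG hH 𝓛G lH = leftFirst-+-comm aH aG (leftFirst-+ˡ aH aG hH hG lH 𝓛G)

outcome≡𝓛⇒Is𝓛 : ∀ G → outcome G ≡ 𝓛 → Is𝓛 G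
outcome≡𝓛⇒Is𝓛 G o with leftFirst G | rightFirst G | o
... | true  | false | _  = refl , refl
... | true  | true  | ()
... | false | true  | ()
... | false | false | ()

Is𝓛⇒outcome≡𝓛 : ∀ G → Is𝓛 G → outcome G ≡ 𝓛
Is𝓛⇒outcome≡𝓛 _ (l , r) rewrite l | r = refl

outcome≡𝓝⇒leftFirst : ∀ G → outcome G ≡ 𝓝 → leftFirst G ≡ true
outcome≡𝓝⇒leftFirst G o with leftFirst G | rightFirst G | o
... | true  | _     | _  = refl
... | false | true  | ()
... | false | false | ()

𝓛+𝓛 : ∀ {G H} → Hereditarily Admissible G → Hereditarily Admissible H →
  outcome G ≡ 𝓛 → outcome H ≡ 𝓛 → outcome (G + H) ≡ 𝓛
𝓛+𝓛 {G} {H} hG hH oG oH = Is𝓛⇒outcome≡𝓛 (G + H)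
  (Is𝓛-+ (⊏-wellFounded G) (⊏-wellFounded H) hG hH (outcome≡𝓛⇒Is𝓛 G oG) (outcome≡𝓛⇒Is𝓛 H oH))

𝓛+𝓝-leftFirst : ∀ {G H} → Hereditarily Admissible G → Hereditarily Admissible H →
  outcome G ≡ 𝓛 → outcome H ≡ 𝓝 → leftFirst (G + H) ≡ true
𝓛+𝓝-leftFirst {G} {H} hG hH oG oH = leftFirst-+ʳ (⊏-wellFounded G) (⊏-wellFounded H) hG hH
  (outcome≡𝓛⇒Is𝓛 G oG) (outcome≡𝓝⇒leftFirst H oH)

-- Conjugation

infix 30 -_

mutual
  -_ : Game → Game
  - mk l r = mk (negs r) (negs l)

  negs : List Game → List Game
  negs []       = []
  negs (x ∷ xs) = - x ∷ negs xs

mutual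
  -‿involutive : ∀ G → - - G ≡ G
  -‿involutive (mk l r) = cong₂ mk (negs-involutive l) (negs-involutive r)

  negs-involutive : ∀ xs → negs (negs xs) ≡ xs
  negs-involutive []       = refl
  negs-involutive (x ∷ xs) = cong₂ _∷_ (-‿involutive x) (negs-involutive xs)

mutual
  leftFirst-neg : ∀ G → leftFirst (- G) ≡ rightFirst G
  leftFirst-neg (mk _ [])       = refl
  leftFirst-neg (mk _ (x ∷ xs)) = anyLeft-negs (x ∷ xs)

  rightFirst-neg : ∀ G → rightFirst (- G) ≡ leftFirst G
  rightFirst-neg (mk [] _)       = refl
  rightFirst-neg (mk (x ∷ xs) _) = anyRight-negs (x ∷ xs)

  anyLeft-negs : ∀ xs → anyLeft (negs xs) ≡ anyRight xs
  anyLeft-negs []       = refl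
  anyLeft-negs (x ∷ xs) = cong₂ (λ a b → not a ∨ b) (rightFirst-neg x) (anyLeft-negs xs)

  anyRight-negs : ∀ xs → anyRight (negs xs) ≡ anyLeft xs
  anyRight-negs []       = refl
  anyRight-negs (x ∷ xs) = cong₂ (λ a b → not a ∨ b) (leftFirst-neg x) (anyRight-negs xs)

negs-++ : ∀ xs ys → negs (xs ++ ys) ≡ negs xs ++ negs ys
negs-++ []       _  = refl
negs-++ (x ∷ xs) ys = cong (- x ∷_) (negs-++ xs ys)

mutual
  -‿distrib-+ : ∀ G H → - (G + H) ≡ - G + - H
  -‿distrib-+ (mk gl gr) (mk hl hr) = cong₂ mk
    (trans (negs-++ (sumL gr _) _) (cong₂ _++_ (negs-sumL gr _) (negs-sumR _ hr)))
    (trans (negs-++ (sumL gl _) _) (cong₂ _++_ (negs-sumL gl _) (negs-sumR _ hl)))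

  negs-sumL : ∀ xs H → negs (sumL xs H) ≡ sumL (negs xs) (- H)
  negs-sumL []       _ = refl
  negs-sumL (x ∷ xs) H = cong₂ _∷_ (-‿distrib-+ x H) (negs-sumL xs H)

  negs-sumR : ∀ G ys → negs (sumR G ys) ≡ sumR (- G) (negs ys)
  negs-sumR _ []       = refl
  negs-sumR G (y ∷ ys) = cong₂ _∷_ (-‿distrib-+ G y) (negs-sumR G ys)

∈-negs : ∀ {X xs} → X ∈ xs → - X ∈ negs xs
∈-negs (here refl)  = here refl
∈-negs (there X∈xs) = there (∈-negs X∈xs)

∈-leftOpts-neg : ∀ G {X} → X ∈ rightOpts G → - X ∈ leftOpts (- G)
∈-leftOpts-neg (mk _ _) = ∈-negs

∈-rightOpts-neg : ∀ G {X} → X ∈ leftOpts G → - X ∈ rightOpts (- G)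
∈-rightOpts-neg (mk _ _) = ∈-negs

Subpos-neg : ∀ {K G} → Subpos K G → Subpos (- K) (- G)
Subpos-neg here                = here
Subpos-neg (viaL {G = G} X∈ s) = viaR (∈-rightOpts-neg G X∈) (Subpos-neg s)
Subpos-neg (viaR {G = G} X∈ s) = viaL (∈-leftOpts-neg G X∈) (Subpos-neg s)

Subpos-neg⁻ : ∀ {K G} → Subpos K (- G) → Subpos (- K) G
Subpos-neg⁻ {K} {G} = subst (Subpos (- K)) (-‿involutive G) ∘ Subpos-neg

rightOpts-neg-[] : ∀ K → leftOpts K ≡ [] → rightOpts (- K) ≡ []
rightOpts-neg-[] (mk [] _) _ = refl

NearBlockedRightEnd : Game → Set
NearBlockedRightEnd Y = BlockedRightEnd Y ⊎ ∃[ V ] V ∈ rightOpts Y × BlockedRightEnd V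

mutual
  BlockedRightEnd-neg : ∀ {X} → BlockedRightEnd X → BlockedLeftEnd (- X)
  BlockedRightEnd-neg (blockedR {xl} blocked) = blockedL λ Y Y∈ →
    subst NearBlockedLeftEnd (-‿involutive Y)
      (NearBlockedRightEnd-neg (blocked (- Y) (subst (- Y ∈_) (negs-involutive xl) (∈-negs Y∈))))

  NearBlockedRightEnd-neg : ∀ {Y} → NearBlockedRightEnd Y → NearBlockedLeftEnd (- Y)
  NearBlockedRightEnd-neg (inj₁ b) = inj₁ (BlockedRightEnd-neg b)
  NearBlockedRightEnd-neg {Y} (inj₂ (Z , Z∈ , b)) =
    inj₂ (- Z , ∈-leftOpts-neg Y Z∈ , BlockedRightEnd-neg b)

conjugate : Outcome → Outcome
conjugate 𝓛 = 𝓡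
conjugate 𝓝 = 𝓝
conjugate 𝓟 = 𝓟
conjugate 𝓡 = 𝓛

conjugate-involutive : ∀ o → conjugate (conjugate o) ≡ o
conjugate-involutive 𝓛 = refl
conjugate-involutive 𝓝 = refl
conjugate-involutive 𝓟 = refl
conjugate-involutive 𝓡 = refl

outcome-neg : ∀ G → outcome (- G) ≡ conjugate (outcome G)
outcome-neg G rewrite leftFirst-neg G | rightFirst-neg G with leftFirst G | rightFirst G
... | true  | true  = refl
... | true  | false = refl
... | false | true  = refl
... | false | false = refl

outcome-neg≡ : ∀ G {o} → outcome G ≡ o → outcome (- G) ≡ conjugate o
outcome-neg≡ G o = trans (outcome-neg G) (cong conjugate o)

outcome-neg≡⁻ : ∀ G {o} → outcome (- G) ≡ o → outcome G ≡ conjugate o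
outcome-neg≡⁻ G o =
  trans (sym (conjugate-involutive (outcome G))) (cong conjugate (trans (sym (outcome-neg G)) o))

Blocking⇒Admissible : ∀ {G} → Blocking G → StrictlyPFree G → Hereditarily Admissible G
Blocking⇒Admissible bG pG K s = record
  { not𝓟            = pG K s
  ; leftEnd-blocked = proj₁ (bG K s)
  }

Blocking⇒Admissible-neg : ∀ {G} → Blocking G → StrictlyPFree G → Hereditarily Admissible (- G)
Blocking⇒Admissible-neg bG pG K s = record
  { not𝓟            = pG (- K) s′ ∘ outcome-neg≡ K
  ; leftEnd-blocked = subst BlockedLeftEnd (-‿involutive K) ∘ BlockedRightEnd-neg
                      ∘ proj₂ (bG (- K) s′) ∘ rightOpts-neg-[] K
  }
  where
  s′ = Subpos-neg⁻ s

𝓡+𝓡 : ∀ {G H} → Hereditarily Admissible (- G) → Hereditarily Admissible (- H) →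
  outcome G ≡ 𝓡 → outcome H ≡ 𝓡 → outcome (G + H) ≡ 𝓡
𝓡+𝓡 {G} {H} h-G h-H oG oH = outcome-neg≡⁻ (G + H)
  (trans (cong outcome (-‿distrib-+ G H)) (𝓛+𝓛 h-G h-H (outcome-neg≡ G oG) (outcome-neg≡ H oH)))

𝓡+𝓝-rightFirst : ∀ {G H} → Hereditarily Admissible (- G) → Hereditarily Admissible (- H) →
  outcome G ≡ 𝓡 → outcome H ≡ 𝓝 → rightFirst (G + H) ≡ true
𝓡+𝓝-rightFirst {G} {H} h-G h-H oG oH = begin
  rightFirst (G + H)   ≡⟨ leftFirst-neg (G + H) ⟨
  leftFirst (- (G + H)) ≡⟨ cong leftFirst (-‿distrib-+ G H) ⟩
  leftFirst (- G + - H) ≡⟨ 𝓛+𝓝-leftFirst h-G h-H (outcome-neg≡ G oG) (outcome-neg≡ H oH) ⟩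
  true                  ∎
  where open ≡-Reasoning

leftFirst⇒oL : ∀ G → leftFirst G ≡ true → oL G ≡ Left
leftFirst⇒oL _ l rewrite l = refl

rightFirst⇒oR : ∀ G → rightFirst G ≡ true → oR G ≡ Right
rightFirst⇒oR _ r rewrite r = refl

lemma4p2 : (G H : Game) → Blocking G → Blocking H →
    StrictlyPFree G → StrictlyPFree H →
    ((outcome G ≡ 𝓛 → outcome H ≡ 𝓛 → outcome (G + H) ≡ 𝓛) ×
     (outcome G ≡ 𝓡 → outcome H ≡ 𝓡 → outcome (G + H) ≡ 𝓡) ×
     (outcome G ≡ 𝓛 → outcome H ≡ 𝓝 → oL (G + H) ≡ Left) ×
     (outcome G ≡ 𝓡 → outcome H ≡ 𝓝 → oR (G + H) ≡ Right))
lemma4p2 G H bG bH pG pH =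
    𝓛+𝓛 hG hH
  , 𝓡+𝓡 h-G h-H
  , (λ oG oH → leftFirst⇒oL (G + H) (𝓛+𝓝-leftFirst hG hH oG oH))
  , (λ oG oH → rightFirst⇒oR (G + H) (𝓡+𝓝-rightFirst h-G h-H oG oH))
  where
  hG  = Blocking⇒Admissible bG pG
  hH  = Blocking⇒Admissible bH pH
  h-G = Blocking⇒Admissible-neg bG pG
  h-H = Blocking⇒Admissible-neg bH pH
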